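{- Fix integers $k\geq 3$ and $C\geq 1$. There exists a constant $\alpha>0$ (depending only on $k$ and $C$) such that for every instance $I$ of Restricted $k$-TC (with parameter $C$) on $n\geq 2$ vertices, the TTP-$k$ instance $J$ constructed from $I$ as described below satisfies \[ \mathrm{OPT}(J)\leq \alpha\cdot m(m^2-1)\cdot \mathrm{OPT}(I). \]
   Context: $k$-TC: given a complete graph on vertex set $V_I$ with $|V_I|=n$, a depot vertex $o$, non-depot vertices $V_I\setminus\{o\}$, and a nonnegative symmetric weight function $w$ satisfying the triangle inequality, find a minimum-weight set of tours covering all non-depot vertices, where a tour is a closed walk $o,v_1,\dots,v_j,o$ with distinct non-depot $v_i$ and $1\le j\le k$, weighted by the sum of its edge weights. Restricted $k$-TC: additionally all weights are integers in $\{0,\dots,C\}$ and $w(o,v)\geq 1$ for all non-depot $v$. $\mathrm{OPT}(I)$ is the optimal value. Construction of $J$: let $m_0=n-1+nk^2+k-((n-1)\bmod k)$, and let $m=m_0$ if $m_0$ is even and $m=m_0+k$ otherwise (so $m$ is even). $J$ is the TTP-$k$ instance with $m^3$ teams: the $n$ vertices of $I$ together with $m^3-n$ new teams whose home venues are located at the depot, i.e. for each new team $u$, $w(u,v)=w(o,v)$ for every vertex $v$ of $I$, and $w(u,u')=0$ for every other new team $u'$. TTP-$k$: given an even number of teams with symmetric distances satisfying the triangle inequality, find a double round-robin schedule on $2(\#\text{teams}-1)$ days (each team plays once per day; each pair plays twice, once at each home venue) such that no pair plays on two consecutive days, teams start and end at home and travel directly between consecutive venues, and no team plays more than $k$ consecutive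 home or more than $k$ consecutive away games, minimizing total travel distance; $\mathrm{OPT}(J)$ is its optimal value. -}

module Defs where

open import Data.Nat using (ℕ; zero; suc; _+_; _*_; _∸_; _^_; _≤_; _<_)
open import Data.Nat.DivMod using (_%_)
open import Data.Nat.Properties using (_<?_)
open import Data.Fin using (Fin; toℕ; fromℕ<)
open import Data.Fin.Properties using () renaming (_≟_ to _≟ᶠ_)
open import Data.Bool using (Bool; true; false; not; if_then_else_)
open import Data.List using (List; []; _∷_; length; map; upTo; _++_; [_]; allFin)
open import Data.Nat.ListAction using (sum)
open import Data.List.Membership.Propositional using (_∈_)
open import Data.List.Relation.Unary.All using (All)
open import Data.List.Relation.Unary.Any using (Any)
open import Data.List.Relation.Unary.Unique.Propositional using (Unique)
open import Data.Product using (Σ; _×_; ∃-syntax)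
open import Relation.Binary.PropositionalEquality using (_≡_; _≢_)
open import Relation.Nullary using (¬_; yes; no)

-- Weights are only constrained on
-- edges (pairs of distinct vertices); the diagonal w v v is never used.
record RestrictedTC (k C n : ℕ) : Set where
  field
    o     : Fin n
    w     : Fin n → Fin n → ℕ
    sym   : ∀ u v → u ≢ v → w u v ≡ w v u
    tri   : ∀ u v x → u ≢ v → u ≢ x → x ≢ v → w u v ≤ w u x + w x v
    bound : ∀ u v → u ≢ v → w u v ≤ C
    depot : ∀ v → v ≢ o → 1 ≤ w o v

walkCost : ∀ {A : Set} → (A → A → ℕ) → List A → ℕ
walkCost d []            = 0
walkCost d (x ∷ [])      = 0
walkCost d (x ∷ y ∷ xs)  = d x y + walkCost d (y ∷ xs)

module _ {k C n : ℕ} (I : RestrictedTC k C n) where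
  open RestrictedTC I

  -- a tour o, v1, ..., vj, o is given by the list v1 ... vj
  IsTour : List (Fin n) → Set
  IsTour vs = (1 ≤ length vs) × (length vs ≤ k) × Unique vs × All (λ v → v ≢ o) vs

  tourCost : List (Fin n) → ℕ
  tourCost vs = walkCost w (o ∷ vs ++ [ o ])

  IsTourCover : List (List (Fin n)) → Set
  IsTourCover T = All IsTour T × (∀ v → v ≢ o → Any (λ t → v ∈ t) T)

  coverCost : List (List (Fin n)) → ℕ
  coverCost T = sum (map tourCost T)

-- m₀ = n - 1 + n k² + k - ((n-1) mod k); k = 0 never occurs (k ≥ 3)
m₀ : ℕ → ℕ → ℕ
m₀ zero    n = 0
m₀ k@(suc _) n = (n ∸ 1) + n * k ^ 2 + (k ∸ ((n ∸ 1) % k))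

mParam : ℕ → ℕ → ℕ
mParam k n with m₀ k n % 2
... | zero  = m₀ k n
... | suc _ = m₀ k n + k

teamsJ : ℕ → ℕ → ℕ
teamsJ k n = mParam k n ^ 3

-- location (vertex of I) of a team of J: teams 0..n-1 are the vertices
-- of I, all other teams have their home venue at the depot.
module _ {k C n : ℕ} (I : RestrictedTC k C n) where
  open RestrictedTC I

  locJ : Fin (teamsJ k n) → Fin n
  locJ t with toℕ t <? n
  ... | yes p = fromℕ< p
  ... | no _  = o

  distJ : Fin (teamsJ k n) → Fin (teamsJ k n) → ℕ
  distJ t u with locJ t ≟ᶠ locJ u
  ... | yes _ = 0
  ... | no _  = w (locJ t) (locJ u)

sumTo : ℕ → (ℕ → ℕ) → ℕ
sumTo D f = sum (map f (upTo D))

-- A schedule for N teams over days 0 .. D-1 with D = 2(N-1):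
-- opp d t is the opponent of team t on day d, home d t says whether t
-- plays at home on day d.  Values for d ≥ D are irrelevant.
record Schedule (N : ℕ) : Set where
  field
    opp  : ℕ → Fin N → Fin N
    home : ℕ → Fin N → Bool

module _ {N : ℕ} (S : Schedule N) where
  open Schedule S

  days : ℕ
  days = 2 * (N ∸ 1)

  venue : ℕ → Fin N → Fin N
  venue d t = if home d t then t else opp d t

  -- feasible TTP-k schedule (double round robin, no-repeat, at most k
  -- consecutive home / away games)
  IsTTPSchedule : ℕ → Set
  IsTTPSchedule k =
      (∀ d t → d < days → opp d t ≢ t)
    × (∀ d t → d < days → opp d (opp d t) ≡ t)
    × (∀ d t → d < days → home d (opp d t) ≡ not (home d t))
    × (∀ t u → t ≢ u → ∃[ d ] (d < days × opp d t ≡ u × home d t ≡ true))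
    × (∀ t u d d' → d < days → d' < days
         → opp d t ≡ u → home d t ≡ true
         → opp d' t ≡ u → home d' t ≡ true → d ≡ d')
    × (∀ d t → suc d < days → opp (suc d) t ≢ opp d t)
    × (∀ d t → d + k < days → ¬ (∀ i → i ≤ k → home (d + i) t ≡ true))
    × (∀ d t → d + k < days → ¬ (∀ i → i ≤ k → home (d + i) t ≡ false))

  teamTravel : (Fin N → Fin N → ℕ) → Fin N → ℕ
  teamTravel dist t =
    dist t (venue 0 t)
    + sumTo (days ∸ 1) (λ d → dist (venue d t) (venue (suc d) t))
    + dist (venue (days ∸ 1) t) t

  totalTravel : (Fin N → Fin N → ℕ) → ℕ
  totalTravel dist = sum (map (teamTravel dist) (allFin N))

{-# OPTIONS --safe #-}
module Submission where

-- Give the n vertices of I the potential C and the new teams the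
-- potential 0.  Two teams at different venues are not both at the depot, so every distance of J
-- is at most the sum of the potentials of its ends.  A team enters and leaves each venue of its
-- trip, and its venue on a day is its own or its opponent's, so any schedule travels at most
-- (2 + 4D) n C with D = 2(m³ - 1) days, which is at most 10 m (m² - 1) n C.  The n - 1 non-depot
-- vertices lie on tours of at most k vertices, each of cost at least 1, so n ≤ (k + 1) cost(T).
-- A feasible schedule exists since m³ is even: the circle method followed by its mirror image
-- never lets a team play more than three consecutive home or away games.

open import Data.Bool using (Bool; true; false; not; _∧_; _xor_; if_then_else_)
open import Data.Bool.Properties
  using (not-involutive; not-injective; not-¬; not-distribˡ-xor; not-distribʳ-xor; xor-same; xor-inverseˡ; ∧-zeroʳ)
open import Data.Empty using (⊥; ⊥-elim)
open import Data.Fin using (Fin; zero; suc; toℕ; punchIn)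
open import Data.Fin.Permutation using (permutation)
open import Data.Fin.Properties
  using (toℕ-fromℕ<; toℕ<n; toℕ-injective; punchIn-injective; punchInᵢ≢i; injective⇒≤) renaming (_≟_ to _≟ᶠ_)
open import Data.List using (List; []; _∷_; map; tabulate; applyUpTo; allFin; length; concat; _++_; lookup)
open import Data.List.Membership.Propositional using (_∈_)
open import Data.List.Membership.Propositional.Properties using (∈-concat⁺)
open import Data.List.Properties using (map-tabulate; map-upTo; length-++)
open import Data.List.Relation.Unary.All using (All; []; _∷_)
open import Data.List.Relation.Unary.Any using (index)
open import Data.List.Relation.Unary.Any.Properties using (lookup-index)
open import Data.Nat
open import Data.Nat.DivMod
open import Data.Nat.ListAction using (sum)
open import Data.Nat.Properties
open import Algebra.Properties.CommutativeSemigroup +-commutativeSemigroup using (x∙yz≈y∙xz; interchange)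
open import Algebra.Properties.Semiring.Sum +-*-semiring using (sum-syntax; ∑-distrib-+; ∑-comm; sum-permute; *-distribˡ-sum)
open import Data.Nat.Solver using (module +-*-Solver)
open import Data.Product using (_×_; _,_; ∃-syntax; proj₂)
open import Data.Sum using (_⊎_; inj₁; inj₂)
open import Function using (_∘_; id)
open import Level using (0ℓ)
open import Relation.Binary.Bundles using (Setoid)
open import Relation.Binary.PropositionalEquality
import Relation.Binary.Reasoning.Setoid
open import Relation.Nullary using (¬_; Dec; yes; no)
open import Relation.Nullary.Decidable using (dec-true; dec-yes; dec-no)
open +-*-Solver using (solve; _:+_; _:*_; _:=_; con)

open import Defs

-- Arithmetic modulo q

module Congruence (q : ℕ) .{{_ : NonZero q}} where

  infix 4 _≈_
  record _≈_ (a b : ℕ) : Set where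
    constructor mod≡
    field %≡ : a % q ≡ b % q
  open _≈_ public

  ≈-setoid : Setoid 0ℓ 0ℓ
  ≈-setoid = record
    { _≈_ = _≈_
    ; isEquivalence = record
      { refl = mod≡ refl
      ; sym = λ a≈b → mod≡ (sym (%≡ a≈b))
      ; trans = λ a≈b b≈c → mod≡ (trans (%≡ a≈b) (%≡ b≈c))
      }
    }

  open Setoid ≈-setoid public using () renaming (refl to ≈-refl; sym to ≈-sym; reflexive to ≡⇒≈; trans to ≈-trans)
  module ≈-Reasoning = Relation.Binary.Reasoning.Setoid ≈-setoid

  %-≈ : ∀ a → a % q ≈ a
  %-≈ a = mod≡ (m%n%n≡m%n a q)

  +q-≈ : ∀ a → a + q ≈ a
  +q-≈ a = mod≡ ([m+n]%n≡m%n a q)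

  +kq-≈ : ∀ a k → a + k * q ≈ a
  +kq-≈ a k = mod≡ ([m+kn]%n≡m%n a k q)

  +-cong : ∀ {a b c d} → a ≈ b → c ≈ d → a + c ≈ b + d
  +-cong {a} {b} {c} {d} a≈b c≈d = mod≡ (begin
    (a + c) % q                 ≡⟨ %-distribˡ-+ a c q ⟩
    (a % q + c % q) % q         ≡⟨ cong₂ (λ u v → (u + v) % q) (%≡ a≈b) (%≡ c≈d) ⟩
    (b % q + d % q) % q         ≡⟨ %-distribˡ-+ b d q ⟨
    (b + d) % q                 ∎)
    where open ≡-Reasoning

  *-congˡ : ∀ c {a b} → a ≈ b → c * a ≈ c * b
  *-congˡ c {a} {b} a≈b = mod≡ (begin
    (c * a) % q                 ≡⟨ %-distribˡ-* c a q ⟩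
    (c % q * (a % q)) % q       ≡⟨ cong (λ u → (c % q * u) % q) (%≡ a≈b) ⟩
    (c % q * (b % q)) % q       ≡⟨ %-distribˡ-* c b q ⟨
    (c * b) % q                 ∎)
    where open ≡-Reasoning

  +-cancelʳ : ∀ c {a b} → a + c ≈ b + c → a ≈ b
  +-cancelʳ c {a} {b} ac≈bc = begin
    a                       ≈⟨ +kq-≈ a c ⟨
    a + c * q               ≡⟨ shift a ⟩
    a + c + c * (q ∸ 1)     ≈⟨ +-cong ac≈bc ≈-refl ⟩
    b + c + c * (q ∸ 1)     ≡⟨ shift b ⟨
    b + c * q               ≈⟨ +kq-≈ b c ⟩
    b                       ∎
    where
    open ≈-Reasoning
    shift : ∀ x → x + c * q ≡ x + c + c * (q ∸ 1)
    shift x = trans (cong (λ z → x + c * z) (sym (suc-pred q)))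
                    (trans (cong (x +_) (*-suc c (q ∸ 1))) (sym (+-assoc x c _)))

  +-cancelˡ : ∀ c {a b} → c + a ≈ c + b → a ≈ b
  +-cancelˡ c {a} {b} ca≈cb =
    +-cancelʳ c (≈-trans (≡⇒≈ (+-comm a c)) (≈-trans ca≈cb (≡⇒≈ (+-comm c b))))

  ≈⇒≡ : ∀ {a b} → a < q → b < q → a ≈ b → a ≡ b
  ≈⇒≡ {a} {b} a<q b<q a≈b = trans (sym (m<n⇒m%n≡m a<q)) (trans (%≡ a≈b) (m<n⇒m%n≡m b<q))

  ≈0⇒≡q : ∀ {a b} → 0 < a → a < q → b < q → a + b ≈ 0 → a + b ≡ q
  ≈0⇒≡q {a} {b} 0<a a<q b<q a+b≈0 with a + b <? q
  ... | yes a+b<q = ⊥-elim (<⇒≢ (≤-trans 0<a (m≤m+n a b)) (sym (≈⇒≡ a+b<q (<-trans 0<a a<q) a+b≈0)))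
  ... | no a+b≮q = begin
    a + b                ≡⟨ m∸n+n≡m q≤a+b ⟨
    a + b ∸ q + q        ≡⟨ cong (_+ q) excess≡0 ⟩
    q                    ∎
    where
    open ≡-Reasoning
    q≤a+b = ≮⇒≥ a+b≮q
    excess≡0 : a + b ∸ q ≡ 0
    excess≡0 = ≈⇒≡ (m<n+o⇒m∸n<o (a + b) q (+-mono-< a<q b<q)) (<-trans 0<a a<q)
      (≈-trans (≈-sym (+q-≈ (a + b ∸ q))) (≈-trans (≡⇒≈ (m∸n+n≡m q≤a+b)) a+b≈0))

-- Parity

odd : ℕ → Bool
odd zero    = false
odd (suc n) = not (odd n)

odd-+ : ∀ m n → odd (m + n) ≡ odd m xor odd n
odd-+ zero    n = refl
odd-+ (suc m) n = trans (cong not (odd-+ m n)) (not-distribˡ-xor (odd m) (odd n))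

odd-double : ∀ n → odd (n + n) ≡ false
odd-double n = trans (odd-+ n n) (xor-same (odd n))

odd-* : ∀ m n → odd (m * n) ≡ odd m ∧ odd n
odd-* zero    n = refl
odd-* (suc m) n = trans (odd-+ n (m * n)) (trans (cong (odd n xor_) (odd-* m n)) (xor-∧ (odd m) (odd n)))
  where
  xor-∧ : ∀ a b → b xor (a ∧ b) ≡ not a ∧ b
  xor-∧ false false = refl
  xor-∧ false true  = refl
  xor-∧ true  false = refl
  xor-∧ true  true  = refl

%2-odd : ∀ n → n % 2 ≡ (if odd n then 1 else 0)
%2-odd zero          = refl
%2-odd (suc zero)    = refl
%2-odd (suc (suc n)) rewrite not-involutive (odd n) = %2-odd n

%2≡0⇒even : ∀ n → n % 2 ≡ 0 → odd n ≡ false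
%2≡0⇒even n eq with odd n | %2-odd n
... | false | _   = refl
... | true  | n%2 = ⊥-elim (1+n≢0 (trans (sym n%2) eq))

%2≢0⇒odd : ∀ n → n % 2 ≢ 0 → odd n ≡ true
%2≢0⇒odd n neq with odd n | %2-odd n
... | true  | _   = refl
... | false | n%2 = ⊥-elim (neq n%2)

odd≡false⇒double : ∀ n → odd n ≡ false → ∃[ h ] n ≡ h + h
odd≡false⇒double zero          _    = 0 , refl
odd≡false⇒double (suc (suc n)) even with odd≡false⇒double n (trans (sym (not-involutive (odd n))) even)
... | h , refl = suc h , cong suc (sym (+-suc h h))

xor≡true⇒≡not : ∀ a b → a xor b ≡ true → b ≡ not a
xor≡true⇒≡not true  false _ = refl
xor≡true⇒≡not false true  _ = refl

xor-cancelʳ : ∀ a b c → a xor c ≡ b xor c → a ≡ b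
xor-cancelʳ false false _ _   = refl
xor-cancelʳ true  true  _ _   = refl
xor-cancelʳ false true  c eq  = ⊥-elim (not-¬ refl eq)
xor-cancelʳ true  false c eq  = ⊥-elim (not-¬ refl (sym eq))

-- A double round robin with at most three consecutive home or away games

-- The circle method for q + 1 teams, q = 2p + 3: team q is the pivot, in round r < q it meets
-- team r, and any two other teams x and y meet when x + y ≡ 2r (mod q).  Such an x hosts when
-- its offset x - r (mod q) is odd; the offsets of two partners add up to the odd number q.
module CircleMethod (p : ℕ) where

  q : ℕ
  q = 3 + (p + p)

  open Congruence q

  odd-q : odd q ≡ true
  odd-q = cong (not ∘ not ∘ not) (odd-double p)

  odd-q∸1 : odd (q ∸ 1) ≡ false
  odd-q∸1 = cong (not ∘ not) (odd-double p)

  N : ℕ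
  N = suc q

  reflect : ℕ → ℕ → ℕ
  reflect r x = (r + r + (q ∸ x)) % q

  offset : ℕ → ℕ → ℕ
  offset r x = (x + (q ∸ r)) % q

  partner : ℕ → ℕ → ℕ
  partner r x with x ≟ q | x ≟ r
  ... | yes _ | _     = r
  ... | no _  | yes _ = q
  ... | no _  | no _  = reflect r x

  hosts : ℕ → ℕ → Bool
  hosts r x with x ≟ q | x ≟ r
  ... | yes _ | _     = odd r
  ... | no _  | yes _ = not (odd r)
  ... | no _  | no _  = odd (offset r x)

  partner-pivot : ∀ r → partner r q ≡ r
  partner-pivot r rewrite proj₂ (dec-yes (q ≟ q) refl) = refl

  partner-facing : ∀ {r} → r ≢ q → partner r r ≡ q
  partner-facing {r} r≢q rewrite dec-no (r ≟ q) r≢q | proj₂ (dec-yes (r ≟ r) refl) = refl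

  partner-reflect : ∀ {r x} → x ≢ q → x ≢ r → partner r x ≡ reflect r x
  partner-reflect {r} {x} x≢q x≢r rewrite dec-no (x ≟ q) x≢q | dec-no (x ≟ r) x≢r = refl

  hosts-pivot : ∀ r → hosts r q ≡ odd r
  hosts-pivot r rewrite proj₂ (dec-yes (q ≟ q) refl) = refl

  hosts-facing : ∀ {r} → r ≢ q → hosts r r ≡ not (odd r)
  hosts-facing {r} r≢q rewrite dec-no (r ≟ q) r≢q | proj₂ (dec-yes (r ≟ r) refl) = refl

  hosts-offset : ∀ {r x} → x ≢ q → x ≢ r → hosts r x ≡ odd (offset r x)
  hosts-offset {r} {x} x≢q x≢r rewrite dec-no (x ≟ q) x≢q | dec-no (x ≟ r) x≢r = refl

  data Role (r x : ℕ) : Set where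
    pivot  : x ≡ q → Role r x
    facing : x ≡ r → Role r x
    paired : x ≢ q → x ≢ r → Role r x

  role : ∀ r x → Role r x
  role r x with x ≟ q | x ≟ r
  ... | yes x≡q | _       = pivot x≡q
  ... | no _    | yes x≡r = facing x≡r
  ... | no x≢q  | no x≢r  = paired x≢q x≢r

  reflect-< : ∀ r x → reflect r x < q
  reflect-< r x = m%n<n (r + r + (q ∸ x)) q

  offset-< : ∀ r x → offset r x < q
  offset-< r x = m%n<n (x + (q ∸ r)) q

  +-reflect : ∀ r {x} → x < q → x + reflect r x ≈ r + r
  +-reflect r {x} x<q = begin
    x + reflect r x               ≈⟨ +-cong ≈-refl (%-≈ (r + r + (q ∸ x))) ⟩
    x + (r + r + (q ∸ x))         ≡⟨ x∙yz≈y∙xz x (r + r) (q ∸ x) ⟩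
    r + r + (x + (q ∸ x))         ≡⟨ cong (r + r +_) (m+[n∸m]≡n (<⇒≤ x<q)) ⟩
    r + r + q                     ≈⟨ +q-≈ (r + r) ⟩
    r + r                         ∎
    where open ≈-Reasoning

  reflect-involutive : ∀ r {x} → x < q → reflect r (reflect r x) ≡ x
  reflect-involutive r {x} x<q = ≈⇒≡ (reflect-< r y) x<q (+-cancelˡ y (begin
    y + reflect r y     ≈⟨ +-reflect r (reflect-< r x) ⟩
    r + r               ≈⟨ +-reflect r x<q ⟨
    x + y               ≡⟨ +-comm x y ⟩
    y + x               ∎))
    where
    open ≈-Reasoning
    y = reflect r x

  reflect-≢ : ∀ {r x} → r < q → x < q → x ≢ r → reflect r x ≢ r
  reflect-≢ {r} {x} r<q x<q x≢r reflect≡r = x≢r (≈⇒≡ x<q r<q (+-cancelʳ r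
    (≈-trans (≡⇒≈ (cong (x +_) (sym reflect≡r))) (+-reflect r x<q))))

  double-half : ∀ c → (2 + p) * (c + c) ≈ c
  double-half c = ≈-trans (≡⇒≈ (solve 2 (λ p c → (con 2 :+ p) :* (c :+ c) := c :+ c :* (con 3 :+ (p :+ p)))
                                      refl p c))
                          (+kq-≈ c c)

  halve : ∀ {a b} → a < q → b < q → a + a ≈ b + b → a ≡ b
  halve {a} {b} a<q b<q 2a≈2b = ≈⇒≡ a<q b<q (begin
    a                    ≈⟨ double-half a ⟨
    (2 + p) * (a + a)    ≈⟨ *-congˡ (2 + p) 2a≈2b ⟩
    (2 + p) * (b + b)    ≈⟨ double-half b ⟩
    b                    ∎)
    where open ≈-Reasoning

  offset-self : ∀ {r} → r < q → offset r r ≡ 0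
  offset-self {r} r<q = trans (cong (_% q) (m+[n∸m]≡n (<⇒≤ r<q))) (n%n≡0 q)

  offset-injective : ∀ {r x y} → x < q → y < q → offset r x ≡ offset r y → x ≡ y
  offset-injective {r} x<q y<q eq = ≈⇒≡ x<q y<q (+-cancelʳ (q ∸ r) (mod≡ eq))

  offset≡0⇒≡ : ∀ {r x} → r < q → x < q → offset r x ≡ 0 → x ≡ r
  offset≡0⇒≡ {r} r<q x<q eq = offset-injective {r} x<q r<q (trans eq (sym (offset-self r<q)))

  offset-reflect : ∀ {r x} → r < q → x < q → x ≢ r → offset r x + offset r (reflect r x) ≡ q
  offset-reflect {r} {x} r<q x<q x≢r = ≈0⇒≡q 0<offset (offset-< r x) (offset-< r y) (begin
    offset r x + offset r y         ≈⟨ +-cong (%-≈ (x + u)) (%-≈ (y + u)) ⟩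
    (x + u) + (y + u)               ≡⟨ interchange x u y u ⟩
    (x + y) + (u + u)               ≈⟨ +-cong (+-reflect r x<q) ≈-refl ⟩
    (r + r) + (u + u)               ≡⟨ interchange r r u u ⟩
    (r + u) + (r + u)               ≡⟨ cong₂ _+_ r+u≡q r+u≡q ⟩
    q + q                           ≈⟨ +q-≈ q ⟩
    q                               ≈⟨ +q-≈ 0 ⟩
    0                               ∎)
    where
    open ≈-Reasoning
    y = reflect r x
    u = q ∸ r
    r+u≡q = m+[n∸m]≡n (<⇒≤ r<q)
    0<offset : 0 < offset r x
    0<offset = n≢0⇒n>0 (λ eq → x≢r (offset≡0⇒≡ r<q x<q eq))

  partner-≤ : ∀ {r x} → r < q → x ≤ q → partner r x ≤ q
  partner-≤ {r} {x} r<q x≤q with role r x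
  ... | pivot refl       = ≤-trans (≤-reflexive (partner-pivot r)) (<⇒≤ r<q)
  ... | facing refl      = ≤-reflexive (partner-facing (<⇒≢ r<q))
  ... | paired x≢q x≢r   = ≤-trans (≤-reflexive (partner-reflect x≢q x≢r)) (<⇒≤ (reflect-< r x))

  partner-involutive : ∀ {r x} → r < q → x ≤ q → partner r (partner r x) ≡ x
  partner-involutive {r} {x} r<q x≤q with role r x
  ... | pivot refl = trans (cong (partner r) (partner-pivot r)) (partner-facing (<⇒≢ r<q))
  ... | facing refl = trans (cong (partner r) (partner-facing (<⇒≢ r<q))) (partner-pivot r)
  ... | paired x≢q x≢r = begin
    partner r (partner r x)   ≡⟨ cong (partner r) (partner-reflect x≢q x≢r) ⟩
    partner r y               ≡⟨ partner-reflect (<⇒≢ (reflect-< r x)) (reflect-≢ r<q x<q x≢r) ⟩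
    reflect r y               ≡⟨ reflect-involutive r x<q ⟩
    x                         ∎
    where
    open ≡-Reasoning
    x<q = ≤∧≢⇒< x≤q x≢q
    y = reflect r x

  hosts-partner : ∀ {r x} → r < q → x ≤ q → hosts r (partner r x) ≡ not (hosts r x)
  hosts-partner {r} {x} r<q x≤q with role r x
  ... | pivot refl = trans (cong (hosts r) (partner-pivot r))
                           (trans (hosts-facing (<⇒≢ r<q)) (cong not (sym (hosts-pivot r))))
  ... | facing refl = trans (cong (hosts r) (partner-facing (<⇒≢ r<q)))
                           (trans (hosts-pivot r) (trans (sym (not-involutive (odd r)))
                                                         (cong not (sym (hosts-facing (<⇒≢ r<q))))))
  ... | paired x≢q x≢r = begin
    hosts r (partner r x)     ≡⟨ cong (hosts r) (partner-reflect x≢q x≢r) ⟩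
    hosts r y                 ≡⟨ hosts-offset (<⇒≢ (reflect-< r x)) (reflect-≢ r<q x<q x≢r) ⟩
    odd (offset r y)          ≡⟨ xor≡true⇒≡not _ _ odd-sum ⟩
    not (odd (offset r x))    ≡⟨ cong not (hosts-offset x≢q x≢r) ⟨
    not (hosts r x)           ∎
    where
    open ≡-Reasoning
    x<q = ≤∧≢⇒< x≤q x≢q
    y = reflect r x
    odd-sum : odd (offset r x) xor odd (offset r y) ≡ true
    odd-sum = trans (sym (odd-+ (offset r x) (offset r y)))
                    (trans (cong odd (offset-reflect r<q x<q x≢r)) odd-q)

  partner≡q⇒facing : ∀ {r x} → r < q → x ≤ q → partner r x ≡ q → x ≡ r
  partner≡q⇒facing {r} {x} r<q x≤q eq with role r x
  ... | pivot refl     = ⊥-elim (<⇒≢ r<q (trans (sym (partner-pivot r)) eq))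
  ... | facing x≡r      = x≡r
  ... | paired x≢q x≢r = ⊥-elim (<⇒≢ (reflect-< r x) (trans (sym (partner-reflect x≢q x≢r)) eq))

  partner-injective : ∀ {r r' x} → r < q → r' < q → x ≤ q → partner r x ≡ partner r' x → r ≡ r'
  partner-injective {r} {r'} {x} r<q r'<q x≤q eq with role r x
  ... | pivot refl = trans (sym (partner-pivot r)) (trans eq (partner-pivot r'))
  ... | facing refl = partner≡q⇒facing r'<q x≤q (trans (sym eq) (partner-facing (<⇒≢ r<q)))
  ... | paired x≢q x≢r with role r' x
  ...   | pivot x≡q = ⊥-elim (x≢q x≡q)
  ...   | facing refl = ⊥-elim (<⇒≢ (reflect-< r x)
                       (trans (sym (partner-reflect x≢q x≢r)) (trans eq (partner-facing x≢q))))
  ...   | paired _ x≢r' = halve r<q r'<q (begin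
    r + r                 ≈⟨ +-reflect r x<q ⟨
    x + reflect r x       ≡⟨ cong (x +_) reflects ⟩
    x + reflect r' x      ≈⟨ +-reflect r' x<q ⟩
    r' + r'               ∎)
    where
    open ≈-Reasoning
    x<q = ≤∧≢⇒< x≤q x≢q
    reflects : reflect r x ≡ reflect r' x
    reflects = trans (sym (partner-reflect x≢q x≢r)) (trans eq (partner-reflect x≢q x≢r'))

  partner-surjective : ∀ {x y} → x ≤ q → y ≤ q → x ≢ y → ∃[ r ] (r < q × partner r x ≡ y)
  partner-surjective {x} {y} x≤q y≤q x≢y = meet (x ≟ q) (y ≟ q)
    where
    meet : Dec (x ≡ q) → Dec (y ≡ q) → ∃[ r ] (r < q × partner r x ≡ y)
    meet (yes refl) _          = y , ≤∧≢⇒< y≤q (x≢y ∘ sym) , partner-pivot y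
    meet (no x≢q)   (yes refl) = x , ≤∧≢⇒< x≤q x≢q , partner-facing x≢q
    meet (no x≢q)   (no y≢q)   = r , m%n<n ((2 + p) * (x + y)) q ,
      trans (partner-reflect x≢q x≢r) (≈⇒≡ (reflect-< r x) y<q (+-cancelˡ x (begin
        x + reflect r x   ≈⟨ +-reflect r x<q ⟩
        r + r             ≈⟨ r+r≈x+y ⟩
        x + y             ∎)))
      where
      open ≈-Reasoning
      x<q = ≤∧≢⇒< x≤q x≢q
      y<q = ≤∧≢⇒< y≤q y≢q
      r = (2 + p) * (x + y) % q
      r+r≈x+y : r + r ≈ x + y
      r+r≈x+y = begin
        r + r                                  ≈⟨ +-cong (%-≈ ((2 + p) * (x + y))) (%-≈ ((2 + p) * (x + y))) ⟩
        (2 + p) * (x + y) + (2 + p) * (x + y)  ≡⟨ *-distribˡ-+ (2 + p) (x + y) (x + y) ⟨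
        (2 + p) * (x + y + (x + y))            ≈⟨ double-half (x + y) ⟩
        x + y                                  ∎
      x≢r : x ≢ r
      x≢r x≡r = x≢y (≈⇒≡ x<q y<q (+-cancelˡ x (≈-trans (≡⇒≈ (cong₂ _+_ x≡r x≡r)) r+r≈x+y)))

  breakRound : ℕ → ℕ
  breakRound x = if odd x then x else pred x

  offset-pred : ∀ {e x} → suc e < q → x < q → x ≢ e → offset e x ≡ suc (offset (suc e) x)
  offset-pred {e} {x} se<q x<q x≢e = ≈⇒≡ (offset-< e x) s+1<q (≈-sym s+1≈)
    where
    s = offset (suc e) x
    s+1≈ : suc s ≈ offset e x
    s+1≈ = begin
      1 + s                         ≈⟨ +-cong (≈-refl {1}) (%-≈ (x + (q ∸ suc e))) ⟩
      1 + (x + (q ∸ suc e))         ≡⟨ x∙yz≈y∙xz 1 x (q ∸ suc e) ⟩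
      x + (1 + (q ∸ suc e))         ≡⟨ cong (x +_) (+-∸-assoc 1 (<⇒≤ se<q)) ⟨
      x + (q ∸ e)                   ≈⟨ %-≈ (x + (q ∸ e)) ⟨
      offset e x                    ∎
      where open ≈-Reasoning
    s+1≢q : suc s ≢ q
    s+1≢q s+1≡q = x≢e (offset≡0⇒≡ (<-trans (n<1+n e) se<q) x<q
      (≈⇒≡ (offset-< e x) z<s
        (≈-trans (≈-sym s+1≈) (≈-trans (≡⇒≈ s+1≡q) (+q-≈ 0)))))
    s+1<q : suc s < q
    s+1<q = ≤∧≢⇒< (offset-< (suc e) x) s+1≢q

  breakRound-odd : ∀ {e} → odd e ≡ true → breakRound e ≡ e
  breakRound-odd {e} odd-e rewrite odd-e = refl

  breakRound-suc : ∀ {e} → odd e ≡ true → breakRound (suc e) ≡ e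
  breakRound-suc {e} odd-e rewrite odd-e = refl

  hosts-break : ∀ {e x} → suc e < q → x ≤ q → hosts (suc e) x ≡ hosts e x → e ≡ breakRound x
  hosts-break {e} {x} se<q x≤q same with role (suc e) x
  ... | pivot refl =
    ⊥-elim (not-¬ refl (trans (sym (hosts-pivot e)) (trans (sym same) (hosts-pivot (suc e)))))
  ... | facing refl = sym (breakRound-suc odd-e)
    where
    away-facing : hosts e (suc e) ≡ true
    away-facing = begin
      hosts e (suc e)                    ≡⟨ hosts-offset (<⇒≢ se<q) 1+n≢n ⟩
      odd (offset e (suc e))             ≡⟨ cong odd (offset-pred se<q se<q 1+n≢n) ⟩
      odd (suc (offset (suc e) (suc e))) ≡⟨ cong (odd ∘ suc) (offset-self se<q) ⟩
      true                               ∎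
      where open ≡-Reasoning
    odd-e : odd e ≡ true
    odd-e = trans (sym (not-involutive (odd e)))
                  (trans (sym (hosts-facing (<⇒≢ se<q))) (trans same away-facing))
  ... | paired x≢q x≢se with role e x
  ...   | pivot x≡q = ⊥-elim (x≢q x≡q)
  ...   | facing refl = sym (breakRound-odd odd-e)
    where
    offset-last : offset (suc e) e ≡ q ∸ 1
    offset-last = trans (cong (λ z → pred z % q) (m+[n∸m]≡n (<⇒≤ se<q))) (m<n⇒m%n≡m (n<1+n (q ∸ 1)))
    odd-e : odd e ≡ true
    odd-e = not-injective (trans (sym (hosts-facing x≢q)) (trans (sym same)
              (trans (hosts-offset x≢q x≢se) (trans (cong odd offset-last) odd-q∸1))))
  ...   | paired _ x≢e = ⊥-elim (not-¬ refl (begin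
    odd s               ≡⟨ hosts-offset x≢q x≢se ⟨
    hosts (suc e) x     ≡⟨ same ⟩
    hosts e x           ≡⟨ hosts-offset x≢q x≢e ⟩
    odd (offset e x)    ≡⟨ cong odd (offset-pred se<q (≤∧≢⇒< x≤q x≢q) x≢e) ⟩
    not (odd s)         ∎))
    where
    open ≡-Reasoning
    s = offset (suc e) x

module MirroredSchedule (p : ℕ) where

  open CircleMethod p

  D : ℕ
  D = 2 * q

  round : ℕ → ℕ
  round d with d <? q
  ... | yes _ = d
  ... | no _  = d ∸ q

  mirrored : ℕ → Bool
  mirrored d with d <? q
  ... | yes _ = false
  ... | no _  = true

  round-first : ∀ {d} → d < q → round d ≡ d
  round-first {d} d<q rewrite proj₂ (dec-yes (d <? q) d<q) = refl

  round-second : ∀ {d} → q ≤ d → round d ≡ d ∸ q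
  round-second {d} q≤d rewrite dec-no (d <? q) (≤⇒≯ q≤d) = refl

  mirrored-first : ∀ {d} → d < q → mirrored d ≡ false
  mirrored-first {d} d<q rewrite proj₂ (dec-yes (d <? q) d<q) = refl

  mirrored-second : ∀ {d} → q ≤ d → mirrored d ≡ true
  mirrored-second {d} q≤d rewrite dec-no (d <? q) (≤⇒≯ q≤d) = refl

  ∸q-< : ∀ {d} → d < D → d ∸ q < q
  ∸q-< {d} d<D = m<n+o⇒m∸n<o d q (subst (d <_) (cong (q +_) (+-identityʳ q)) d<D)

  round-< : ∀ {d} → d < D → round d < q
  round-< {d} d<D with d <? q
  ... | yes d<q = d<q
  ... | no _    = ∸q-< d<D

  toTeam : ℕ → Fin N
  toTeam y = y mod N

  toℕ-toTeam : ∀ {y} → y ≤ q → toℕ (toTeam y) ≡ y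
  toℕ-toTeam y≤q = trans (toℕ-fromℕ< _) (m<n⇒m%n≡m (s≤s y≤q))

  toℕ≤q : (t : Fin N) → toℕ t ≤ q
  toℕ≤q t = s≤s⁻¹ (toℕ<n t)

  schedule : Schedule N
  schedule = record
    { opp  = λ d t → toTeam (partner (round d) (toℕ t))
    ; home = λ d t → mirrored d xor hosts (round d) (toℕ t)
    }

  open Schedule schedule

  dayOf : Bool → ℕ → ℕ
  dayOf false r = r
  dayOf true  r = q + r

  dayOf-< : ∀ b {r} → r < q → dayOf b r < D
  dayOf-< false r<q = ≤-trans r<q (m≤m+n q (q + 0))
  dayOf-< true  r<q = +-monoʳ-< q (≤-trans r<q (≤-reflexive (sym (+-identityʳ q))))

  round-dayOf : ∀ b {r} → r < q → round (dayOf b r) ≡ r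
  round-dayOf false r<q = round-first r<q
  round-dayOf true {r} r<q = trans (round-second (m≤m+n q r)) (m+n∸m≡n q r)

  mirrored-dayOf : ∀ b {r} → r < q → mirrored (dayOf b r) ≡ b
  mirrored-dayOf false r<q = mirrored-first r<q
  mirrored-dayOf true {r} _ = mirrored-second (m≤m+n q r)

  dayOf-round : ∀ d → dayOf (mirrored d) (round d) ≡ d
  dayOf-round d with d <? q
  ... | yes _   = refl
  ... | no d≮q = m+[n∸m]≡n (≮⇒≥ d≮q)

  toℕ-opp : ∀ {d} t → d < D → toℕ (opp d t) ≡ partner (round d) (toℕ t)
  toℕ-opp t d<D = toℕ-toTeam (partner-≤ (round-< d<D) (toℕ≤q t))

  opp-involutive : ∀ d t → d < D → opp d (opp d t) ≡ t
  opp-involutive d t d<D = toℕ-injective (begin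
    toℕ (opp d (opp d t))                          ≡⟨ toℕ-opp (opp d t) d<D ⟩
    partner (round d) (toℕ (opp d t))              ≡⟨ cong (partner (round d)) (toℕ-opp t d<D) ⟩
    partner (round d) (partner (round d) (toℕ t))  ≡⟨ partner-involutive (round-< d<D) (toℕ≤q t) ⟩
    toℕ t                                          ∎)
    where open ≡-Reasoning

  home-opp : ∀ d t → d < D → home d (opp d t) ≡ not (home d t)
  home-opp d t d<D = begin
    mirrored d xor hosts r (toℕ (opp d t))           ≡⟨ cong (λ y → mirrored d xor hosts r y) (toℕ-opp t d<D) ⟩
    mirrored d xor hosts r (partner r (toℕ t))       ≡⟨ cong (mirrored d xor_) (hosts-partner (round-< d<D) (toℕ≤q t)) ⟩
    mirrored d xor not (hosts r (toℕ t))             ≡⟨ not-distribʳ-xor (mirrored d) (hosts r (toℕ t)) ⟨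
    not (mirrored d xor hosts r (toℕ t))             ∎
    where
    open ≡-Reasoning
    r = round d

  opp-irreflexive : ∀ d t → d < D → opp d t ≢ t
  opp-irreflexive d t d<D opp≡t = not-¬ refl (trans (sym (cong (home d) opp≡t)) (home-opp d t d<D))

  home-game : ∀ t u → t ≢ u → ∃[ d ] (d < D × opp d t ≡ u × home d t ≡ true)
  home-game t u t≢u with partner-surjective (toℕ≤q t) (toℕ≤q u) (t≢u ∘ toℕ-injective)
  ... | r , r<q , meets = dayOf b r , dayOf-< b r<q , opp≡u , home≡true
    where
    b = not (hosts r (toℕ t))
    opp≡u : opp (dayOf b r) t ≡ u
    opp≡u = toℕ-injective (trans (toℕ-opp t (dayOf-< b r<q))
              (trans (cong (λ r' → partner r' (toℕ t)) (round-dayOf b r<q)) meets))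
    home≡true : home (dayOf b r) t ≡ true
    home≡true = trans (cong₂ (λ m r' → m xor hosts r' (toℕ t)) (mirrored-dayOf b r<q) (round-dayOf b r<q))
                      (xor-inverseˡ (hosts r (toℕ t)))

  home-game-unique : ∀ t u d d' → d < D → d' < D → opp d t ≡ u → home d t ≡ true →
                     opp d' t ≡ u → home d' t ≡ true → d ≡ d'
  home-game-unique t u d d' d<D d'<D opp≡u home≡true opp'≡u home'≡true = begin
    d                                  ≡⟨ dayOf-round d ⟨
    dayOf (mirrored d) (round d)       ≡⟨ cong₂ dayOf same-half same-round ⟩
    dayOf (mirrored d') (round d')     ≡⟨ dayOf-round d' ⟩
    d'                                 ∎
    where
    open ≡-Reasoning
    same-round : round d ≡ round d'
    same-round = partner-injective (round-< d<D) (round-< d'<D) (toℕ≤q t)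
      (trans (sym (toℕ-opp t d<D)) (trans (cong toℕ (trans opp≡u (sym opp'≡u))) (toℕ-opp t d'<D)))
    same-half : mirrored d ≡ mirrored d'
    same-half = xor-cancelʳ (mirrored d) (mirrored d') (hosts (round d) (toℕ t))
      (trans home≡true (trans (sym home'≡true)
        (cong (λ r → mirrored d' xor hosts r (toℕ t)) (sym same-round))))

  round-suc≢ : ∀ d → suc d < D → round (suc d) ≢ round d
  round-suc≢ d sd<D = cases (suc d <? q) (d <? q)
    where
    cases : Dec (suc d < q) → Dec (d < q) → round (suc d) ≢ round d
    cases (yes sd<q) _          eq =
      1+n≢n (trans (sym (round-first sd<q)) (trans eq (round-first (<-trans (n<1+n d) sd<q))))
    cases (no sd≮q)  (yes d<q)  eq = <⇒≱ (s≤s (s≤s z≤n)) (subst (λ z → q ≤ suc z) d≡0 (≮⇒≥ sd≮q))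
      where
      d≡0 : d ≡ 0
      d≡0 = trans (sym (round-first d<q))
                  (trans (sym eq) (trans (round-second (≮⇒≥ sd≮q)) (m≤n⇒m∸n≡0 d<q)))
    cases (no sd≮q)  (no d≮q)   eq = 1+n≢n (trans (sym (+-∸-assoc 1 (≮⇒≥ d≮q)))
      (trans (sym (round-second (≮⇒≥ sd≮q))) (trans eq (round-second (≮⇒≥ d≮q)))))

  no-repeat : ∀ d t → suc d < D → opp (suc d) t ≢ opp d t
  no-repeat d t sd<D opp≡opp = round-suc≢ d sd<D
    (partner-injective (round-< sd<D) (round-< d<D) (toℕ≤q t)
      (trans (sym (toℕ-opp t sd<D)) (trans (cong toℕ opp≡opp) (toℕ-opp t d<D))))
    where d<D = <-trans (n<1+n d) sd<D

  BreakDay : ℕ → ℕ → Set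
  BreakDay x d = d ≡ breakRound x ⊎ d ≡ q ∸ 1 ⊎ d ≡ q + breakRound x

  home-repeat⇒BreakDay : ∀ d t → suc d < D → home (suc d) t ≡ home d t → BreakDay (toℕ t) d
  home-repeat⇒BreakDay d t sd<D same with suc d <? q | d <? q
  ... | yes sd<q | yes _    = inj₁ (hosts-break sd<q (toℕ≤q t) same)
  ... | yes sd<q | no d≮q   = ⊥-elim (d≮q (<-trans (n<1+n d) sd<q))
  ... | no sd≮q  | yes d<q  = inj₂ (inj₁ (cong pred (≤-antisym d<q (≮⇒≥ sd≮q))))
  ... | no _     | no d≮q   =
    inj₂ (inj₂ (trans (sym (m+[n∸m]≡n q≤d)) (cong (q +_) (hosts-break r+1<q (toℕ≤q t) same'))))
    where
    q≤d = ≮⇒≥ d≮q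
    r+1≡ : suc d ∸ q ≡ suc (d ∸ q)
    r+1≡ = +-∸-assoc 1 q≤d
    r+1<q : suc (d ∸ q) < q
    r+1<q = subst (_< q) r+1≡ (∸q-< sd<D)
    same' : hosts (suc (d ∸ q)) (toℕ t) ≡ hosts (d ∸ q) (toℕ t)
    same' = not-injective (subst (λ r → not (hosts r (toℕ t)) ≡ not (hosts (d ∸ q) (toℕ t))) r+1≡ same)

  -- the two breaks of a team in the same round are q days apart, so any two breaks at most
  -- two days apart include the mid-season one
  close-breaks : ∀ {x i j} → i < j → j ≤ 2 + i → BreakDay x i → BreakDay x j → i ≡ q ∸ 1 ⊎ j ≡ q ∸ 1
  close-breaks _   _   (inj₂ (inj₁ i≡)) _                = inj₁ i≡
  close-breaks _   _   _                (inj₂ (inj₁ j≡)) = inj₂ j≡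
  close-breaks i<j _   (inj₁ refl)      (inj₁ refl)      = ⊥-elim (<-irrefl refl i<j)
  close-breaks {x} _ j≤ (inj₁ refl)     (inj₂ (inj₂ refl)) =
    ⊥-elim (<⇒≱ (s≤s (s≤s (s≤s z≤n))) (+-cancelʳ-≤ (breakRound x) q 2 j≤))
  close-breaks {x} i<j _ (inj₂ (inj₂ refl)) (inj₁ refl)  = ⊥-elim (m+n≮n q (breakRound x) i<j)
  close-breaks i<j _   (inj₂ (inj₂ refl)) (inj₂ (inj₂ refl)) = ⊥-elim (<-irrefl refl i<j)

  no-three-breaks : ∀ {x d} → BreakDay x d → BreakDay x (1 + d) → BreakDay x (2 + d) → ⊥
  no-three-breaks {x} {d} b₀ b₁ b₂ with close-breaks {x} (s≤s (n≤1+n d)) ≤-refl b₀ b₂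
  ... | inj₁ d≡ with close-breaks {x} (n<1+n (1 + d)) (n≤1+n (2 + d)) b₁ b₂
  ...   | inj₁ 1+d≡ = 1+n≢n (trans 1+d≡ (sym d≡))
  ...   | inj₂ 2+d≡ = m+1+n≢n 1 (trans 2+d≡ (sym d≡))
  no-three-breaks {x} {d} b₀ b₁ b₂ | inj₂ 2+d≡ with close-breaks {x} (n<1+n d) (n≤1+n (1 + d)) b₀ b₁
  ...   | inj₁ d≡   = m+1+n≢n 1 (trans 2+d≡ (sym d≡))
  ...   | inj₂ 1+d≡ = 1+n≢n (trans 2+d≡ (sym 1+d≡))

  bounded-streak : ∀ k → 3 ≤ k → ∀ b d t → d + k < D → ¬ (∀ i → i ≤ k → home (d + i) t ≡ b)
  bounded-streak k 3≤k b d t d+k<D streak =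
    no-three-breaks {toℕ t} (break 0 z≤n) (break 1 (s≤s z≤n)) (break 2 ≤-refl)
    where
    at : ∀ i → i ≤ 3 → home (i + d) t ≡ b
    at i i≤3 = subst (λ j → home j t ≡ b) (+-comm d i) (streak i (≤-trans i≤3 3≤k))
    break : ∀ i → i ≤ 2 → BreakDay (toℕ t) (i + d)
    break i i≤2 = home-repeat⇒BreakDay (i + d) t
      (≤-<-trans (≤-trans (+-monoˡ-≤ d (≤-trans (s≤s i≤2) 3≤k)) (≤-reflexive (+-comm k d))) d+k<D)
      (trans (at (suc i) (s≤s i≤2)) (sym (at i (≤-trans i≤2 (n≤1+n 2)))))

  isTTPSchedule : ∀ k → 3 ≤ k → IsTTPSchedule schedule k
  isTTPSchedule k 3≤k =
    opp-irreflexive , opp-involutive , home-opp , home-game , home-game-unique , no-repeat ,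
    bounded-streak k 3≤k true , bounded-streak k 3≤k false

ttp-schedule : ∀ k → 3 ≤ k → ∀ {N} → odd N ≡ false → 3 ≤ N → ∃[ S ] IsTTPSchedule {N} S k
ttp-schedule k 3≤k {N} even 3≤N with odd≡false⇒double N even
... | zero , refl        = ⊥-elim (<⇒≱ 3≤N z≤n)
... | suc zero , refl    = ⊥-elim (<⇒≱ 3≤N (s≤s (s≤s z≤n)))
... | suc (suc p) , refl =
  subst (λ N → ∃[ S ] IsTTPSchedule {N} S k) (sym N≡) (schedule , isTTPSchedule k 3≤k)
  where
  open MirroredSchedule p
  N≡ : suc (suc p) + suc (suc p) ≡ 4 + (p + p)
  N≡ = cong (2 +_) (trans (+-suc p (suc p)) (cong suc (+-suc p p)))

-- Travel bounded by a potential

sum-tabulate : ∀ {n} (f : Fin n → ℕ) → sum (tabulate f) ≡ ∑[ i < n ] f i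
sum-tabulate {zero}  f = refl
sum-tabulate {suc n} f = cong (f zero +_) (sum-tabulate (f ∘ suc))

sum-allFin : ∀ {n} (f : Fin n → ℕ) → sum (map f (allFin n)) ≡ ∑[ i < n ] f i
sum-allFin {n} f = trans (cong sum (map-tabulate id f)) (sum-tabulate f)

sum-applyUpTo : ∀ n (g : ℕ → ℕ) → sum (applyUpTo g n) ≡ ∑[ i < n ] g (toℕ i)
sum-applyUpTo zero    g = refl
sum-applyUpTo (suc n) g = cong (g 0 +_) (sum-applyUpTo n (g ∘ suc))

sumTo-∑ : ∀ n (g : ℕ → ℕ) → sumTo n g ≡ ∑[ i < n ] g (toℕ i)
sumTo-∑ n g = trans (cong sum (map-upTo g n)) (sum-applyUpTo n g)

∑-mono-≤ : ∀ {n} {f g : Fin n → ℕ} → (∀ i → f i ≤ g i) → ∑[ i < n ] f i ≤ ∑[ i < n ] g i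
∑-mono-≤ {zero}  f≤g = z≤n
∑-mono-≤ {suc n} f≤g = +-mono-≤ (f≤g zero) (∑-mono-≤ (f≤g ∘ suc))

∑-≤-* : ∀ {n} {f : Fin n → ℕ} c → (∀ i → f i ≤ c) → ∑[ i < n ] f i ≤ n * c
∑-≤-* {zero}  c f≤c = z≤n
∑-≤-* {suc n} c f≤c = +-mono-≤ (f≤c zero) (∑-≤-* c (f≤c ∘ suc))

∑-involution : ∀ {n} (f : Fin n → ℕ) (σ : Fin n → Fin n) → (∀ i → σ (σ i) ≡ i) →
               ∑[ i < n ] f (σ i) ≡ ∑[ i < n ] f i
∑-involution f σ σσ≡id = sym (sum-permute f (permutation σ σ σσ≡id σσ≡id))

-- a walk through g 0, ..., g M counts every inner term twice and each end term once
∑-adjacent : ∀ M (g : ℕ → ℕ) →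
             g 0 + ∑[ d < M ] (g (toℕ d) + g (suc (toℕ d))) + g M ≡ 2 * ∑[ d < suc M ] g (toℕ d)
∑-adjacent zero    g = solve 1 (λ a → a :+ con 0 :+ a := con 2 :* (a :+ con 0)) refl (g 0)
∑-adjacent (suc M) g = begin
  g 0 + ((g 0 + g 1) + A) + g (suc M)   ≡⟨ solve 4 (λ a b s c → a :+ ((a :+ b) :+ s) :+ c := (a :+ a) :+ (b :+ s :+ c))
                                                   refl (g 0) (g 1) A (g (suc M)) ⟩
  (g 0 + g 0) + (g 1 + A + g (suc M))   ≡⟨ cong (g 0 + g 0 +_) (∑-adjacent M (g ∘ suc)) ⟩
  (g 0 + g 0) + 2 * B                   ≡⟨ solve 2 (λ a b → (a :+ a) :+ con 2 :* b := con 2 :* (a :+ b)) refl (g 0) B ⟩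
  2 * (g 0 + B)                         ∎
  where
  open ≡-Reasoning
  A = ∑[ d < M ] (g (suc (toℕ d)) + g (suc (suc (toℕ d))))
  B = ∑[ d < suc M ] g (suc (toℕ d))

module TravelBound {N : ℕ} (S : Schedule N) (δ : Fin N → ℕ) {dist : Fin N → Fin N → ℕ}
                   (dist≤ : ∀ a b → dist a b ≤ δ a + δ b) where

  open Schedule S

  Σδ : ℕ
  Σδ = ∑[ t < N ] δ t

  teamTravel-≤ : 1 ≤ days S → ∀ t →
                 teamTravel S dist t ≤ 2 * δ t + 2 * ∑[ d < days S ] δ (venue S (toℕ d) t)
  teamTravel-≤ 1≤D t = begin
    teamTravel S dist t
      ≤⟨ +-mono-≤ (+-mono-≤ (dist≤ t (v 0)) steps-≤) (dist≤ (v M) t) ⟩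
    δ t + δ (v 0) + A + (δ (v M) + δ t)
      ≡⟨ solve 4 (λ a b s c → a :+ b :+ s :+ (c :+ a) := con 2 :* a :+ (b :+ s :+ c))
                 refl (δ t) (δ (v 0)) A (δ (v M)) ⟩
    2 * δ t + (δ (v 0) + A + δ (v M))
      ≡⟨ cong (2 * δ t +_) (∑-adjacent M δv) ⟩
    2 * δ t + 2 * ∑[ d < suc M ] δv (toℕ d)
      ≡⟨ cong (λ n → 2 * δ t + 2 * ∑[ d < n ] δv (toℕ d)) (m+[n∸m]≡n 1≤D) ⟩
    2 * δ t + 2 * ∑[ d < days S ] δv (toℕ d)
      ∎
    where
    open ≤-Reasoning
    M = days S ∸ 1
    v : ℕ → Fin N
    v d = venue S d t
    δv : ℕ → ℕ
    δv = δ ∘ v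
    A = ∑[ d < M ] (δv (toℕ d) + δv (suc (toℕ d)))
    steps-≤ : sumTo M (λ d → dist (v d) (v (suc d))) ≤ A
    steps-≤ = ≤-trans (≤-reflexive (sumTo-∑ M (λ d → dist (v d) (v (suc d)))))
                      (∑-mono-≤ {M} (λ d → dist≤ (v (toℕ d)) (v (suc (toℕ d)))))

  venues-≤ : ∀ d → (∀ t → opp d (opp d t) ≡ t) → ∑[ t < N ] δ (venue S d t) ≤ 2 * Σδ
  venues-≤ d involutive = begin
    ∑[ t < N ] δ (venue S d t)             ≤⟨ ∑-mono-≤ venue-≤ ⟩
    ∑[ t < N ] (δ t + δ (opp d t))         ≡⟨ ∑-distrib-+ δ (δ ∘ opp d) ⟩
    Σδ + ∑[ t < N ] δ (opp d t)            ≡⟨ cong (Σδ +_) (∑-involution δ (opp d) involutive) ⟩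
    Σδ + Σδ                                ≡⟨ cong (Σδ +_) (+-identityʳ Σδ) ⟨
    2 * Σδ                                 ∎
    where
    open ≤-Reasoning
    venue-≤ : ∀ t → δ (venue S d t) ≤ δ t + δ (opp d t)
    venue-≤ t with home d t
    ... | true  = m≤m+n (δ t) _
    ... | false = m≤n+m _ (δ t)

  totalTravel-≤ : 1 ≤ days S → (∀ d t → d < days S → opp d (opp d t) ≡ t) →
                  totalTravel S dist ≤ (2 + 4 * days S) * Σδ
  totalTravel-≤ 1≤D involutive = begin
    totalTravel S dist
      ≡⟨ sum-allFin (teamTravel S dist) ⟩
    ∑[ t < N ] teamTravel S dist t
      ≤⟨ ∑-mono-≤ (teamTravel-≤ 1≤D) ⟩
    ∑[ t < N ] (2 * δ t + 2 * X t)
      ≡⟨ ∑-distrib-+ (λ t → 2 * δ t) (λ t → 2 * X t) ⟩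
    ∑[ t < N ] (2 * δ t) + ∑[ t < N ] (2 * X t)
      ≡⟨ cong₂ _+_ (*-distribˡ-sum 2 δ) (*-distribˡ-sum 2 X) ⟨
    2 * Σδ + 2 * ∑[ t < N ] X t
      ≡⟨ cong (λ s → 2 * Σδ + 2 * s) (∑-comm {N} {D} (λ t d → δ (venue S (toℕ d) t))) ⟩
    2 * Σδ + 2 * ∑[ d < D ] ∑[ t < N ] δ (venue S (toℕ d) t)
      ≤⟨ +-monoʳ-≤ (2 * Σδ) (*-monoʳ-≤ 2 (∑-≤-* (2 * Σδ) venues-daily)) ⟩
    2 * Σδ + 2 * (D * (2 * Σδ))
      ≡⟨ solve 2 (λ s D → con 2 :* s :+ con 2 :* (D :* (con 2 :* s)) := (con 2 :+ con 4 :* D) :* s)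
                 refl Σδ D ⟩
    (2 + 4 * D) * Σδ
      ∎
    where
    open ≤-Reasoning
    D = days S
    X : Fin N → ℕ
    X t = ∑[ d < D ] δ (venue S (toℕ d) t)
    venues-daily : ∀ (d : Fin D) → ∑[ t < N ] δ (venue S (toℕ d) t) ≤ 2 * Σδ
    venues-daily d = venues-≤ (toℕ d) (λ t → involutive (toℕ d) t (toℕ<n d))

-- The instances I and J

module _ {k C n : ℕ} (I : RestrictedTC k C n) where

  open RestrictedTC I using (o; w; depot)

  length-concat-≤ : ∀ T → All (IsTour I) T → length (concat T) ≤ k * length T
  length-concat-≤ []      []                    = z≤n
  length-concat-≤ (t ∷ T) ((_ , t≤k , _) ∷ tours) = begin
    length (t ++ concat T)          ≡⟨ length-++ t ⟩
    length t + length (concat T)    ≤⟨ +-mono-≤ t≤k (length-concat-≤ T tours) ⟩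
    k + k * length T                ≡⟨ *-suc k (length T) ⟨
    k * length (t ∷ T)              ∎
    where open ≤-Reasoning

  tourCost-≥1 : ∀ t → IsTour I t → 1 ≤ tourCost I t
  tourCost-≥1 (v ∷ vs) (_ , _ , _ , v≢o ∷ _) = ≤-trans (depot v v≢o) (m≤m+n (w o v) _)

  length-≤-coverCost : ∀ T → All (IsTour I) T → length T ≤ coverCost I T
  length-≤-coverCost []      []             = z≤n
  length-≤-coverCost (t ∷ T) (tour ∷ tours) =
    +-mono-≤ (tourCost-≥1 t tour) (length-≤-coverCost T tours)

-- punching the depot out of Fin (suc n) enumerates the non-depot vertices
nonDepot-≤-length : ∀ {k C n} (I : RestrictedTC k C (suc n)) T → IsTourCover I T → n ≤ length (concat T)
nonDepot-≤-length I T (_ , covered) = injective⇒≤ {f = position} position-injective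
  where
  open RestrictedTC I using (o)
  visited : ∀ i → punchIn o i ∈ concat T
  visited i = ∈-concat⁺ (covered (punchIn o i) (punchInᵢ≢i o i))
  position = λ i → index (visited i)
  position-injective : ∀ {i j} → position i ≡ position j → i ≡ j
  position-injective {i} {j} eq = punchIn-injective o i j
    (trans (lookup-index (visited i)) (trans (cong (lookup (concat T)) eq) (sym (lookup-index (visited j)))))

coverCost-bound : ∀ {k C n} (I : RestrictedTC k C n) T → 2 ≤ n → IsTourCover I T →
                  n ≤ (k + 1) * coverCost I T
coverCost-bound {k} {n = suc n} I T (s≤s 1≤n) cover@(tours , _) = begin
  suc n                ≤⟨ s≤s n≤k*cost ⟩
  suc (k * cost)       ≤⟨ +-monoˡ-≤ (k * cost) 1≤cost ⟩
  cost + k * cost      ≡⟨ cong (_* cost) (+-comm 1 k) ⟩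
  (k + 1) * cost       ∎
  where
  open ≤-Reasoning
  cost = coverCost I T
  n≤k*cost : n ≤ k * cost
  n≤k*cost = ≤-trans (nonDepot-≤-length I T cover)
               (≤-trans (length-concat-≤ I T tours) (*-monoʳ-≤ k (length-≤-coverCost I T tours)))
  1≤cost : 1 ≤ cost
  1≤cost = n≢0⇒n>0 (λ cost≡0 →
    <⇒≱ 1≤n (≤-trans n≤k*cost (≤-reflexive (trans (cong (k *_) cost≡0) (*-zeroʳ k)))))

∑-initial : ∀ N n c → ∑[ t < N ] (if toℕ t <ᵇ n then c else 0) ≤ n * c
∑-initial zero    n       c = z≤n
∑-initial (suc N) zero    c = ≤-trans (∑-≤-* {suc N} 0 (λ _ → ≤-refl)) (≤-reflexive (*-zeroʳ (suc N)))
∑-initial (suc N) (suc n) c = +-monoʳ-≤ c (∑-initial N n c)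

module _ {k C n : ℕ} (I : RestrictedTC k C n) where

  open RestrictedTC I using (o; bound)

  potential : ∀ {N} → Fin N → ℕ
  potential t = if toℕ t <ᵇ n then C else 0

  potential-< : ∀ {N} (t : Fin N) → toℕ t < n → potential t ≡ C
  potential-< t t<n = cong (if_then C else 0) (dec-true (toℕ t <? n) t<n)

  locJ-≥ : ∀ t → ¬ toℕ t < n → locJ I t ≡ o
  locJ-≥ t t≮n with toℕ t <? n
  ... | yes t<n = ⊥-elim (t≮n t<n)
  ... | no _    = refl

  -- two teams at different venues cannot both be located at the depot
  distJ-≤ : ∀ a b → distJ I a b ≤ potential a + potential b
  distJ-≤ a b with locJ I a ≟ᶠ locJ I b
  ... | yes _      = z≤n
  ... | no locs≢   = ≤-trans (bound _ _ locs≢) (C≤ (toℕ a <? n) (toℕ b <? n))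
    where
    C≤ : Dec (toℕ a < n) → Dec (toℕ b < n) → C ≤ potential a + potential b
    C≤ (yes a<n) _         = ≤-trans (≤-reflexive (sym (potential-< a a<n))) (m≤m+n _ _)
    C≤ (no _)    (yes b<n) = ≤-trans (≤-reflexive (sym (potential-< b b<n))) (m≤n+m _ _)
    C≤ (no a≮n)  (no b≮n)  = ⊥-elim (locs≢ (trans (locJ-≥ a a≮n) (sym (locJ-≥ b b≮n))))

  ∑potential-≤ : ∀ N → ∑[ t < N ] potential t ≤ n * C
  ∑potential-≤ N = ∑-initial N n C

-- the reason why adding k to an odd m₀ makes m even
m₀-multiple : ∀ k' n → m₀ (suc k') n ≡ (1 + (n ∸ 1) / suc k' + n * suc k') * suc k'
m₀-multiple k' n = begin
  a + n * K ^ 2 + (K ∸ r)                 ≡⟨ cong (λ z → z + n * K ^ 2 + (K ∸ r)) (m≡m%n+[m/n]*n a K) ⟩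
  r + Q * K + n * K ^ 2 + (K ∸ r)         ≡⟨ solve 5 (λ r Q K n s → r :+ Q :* K :+ n :* (K :* (K :* con 1)) :+ s
                                                      := (r :+ s) :+ (Q :+ n :* K) :* K) refl r Q K n (K ∸ r) ⟩
  (r + (K ∸ r)) + (Q + n * K) * K         ≡⟨ cong (_+ (Q + n * K) * K) (m+[n∸m]≡n (m%n≤n a K)) ⟩
  K + (Q + n * K) * K                     ∎
  where
  open ≡-Reasoning
  K = suc k'
  a = n ∸ 1
  r = a % K
  Q = a / K

mParam-even : ∀ k' n → odd (mParam (suc k') n) ≡ false
mParam-even k' n with m₀ (suc k') n % 2 in m₀%2
... | zero  = %2≡0⇒even (m₀ (suc k') n) m₀%2
... | suc _ = begin
  odd (m₀ K n + K)               ≡⟨ odd-+ (m₀ K n) K ⟩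
  odd (m₀ K n) xor odd K         ≡⟨ cong₂ _xor_ odd-m₀ odd-K ⟩
  false                          ∎
  where
  open ≡-Reasoning
  K = suc k'
  odd-m₀ : odd (m₀ K n) ≡ true
  odd-m₀ = %2≢0⇒odd (m₀ K n) (λ eq → 1+n≢0 (trans (sym m₀%2) eq))
  odd-K : odd K ≡ true
  odd-K with odd K in odd-K≡
  ... | true  = refl
  ... | false = sym (trans (sym odd-m₀) (trans (cong odd (m₀-multiple k' n))
                  (trans (odd-* c K) (trans (cong (odd c ∧_) odd-K≡) (∧-zeroʳ (odd c))))))
    where c = 1 + (n ∸ 1) / K + n * K

k≤mParam : ∀ k' n → 1 ≤ n → suc k' ≤ mParam (suc k') n
k≤mParam k' n@(suc _) _ = ≤-trans k≤m₀ m₀≤mParam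
  where
  K = suc k'
  k≤m₀ : K ≤ m₀ K n
  k≤m₀ = ≤-trans (m≤m*n K (K * 1)) (≤-trans (m≤n*m (K ^ 2) n)
           (≤-trans (m≤n+m (n * K ^ 2) (n ∸ 1)) (m≤m+n _ (K ∸ (n ∸ 1) % K))))
  m₀≤mParam : m₀ K n ≤ mParam K n
  m₀≤mParam with m₀ K n % 2
  ... | zero  = ≤-refl
  ... | suc _ = m≤m+n (m₀ K n) K

3≤mParam : ∀ k n → 3 ≤ k → 2 ≤ n → 3 ≤ mParam k n
3≤mParam k@(suc k') n 3≤k 2≤n = ≤-trans 3≤k (k≤mParam k' n (≤-trans (s≤s z≤n) 2≤n))

teamsJ-even : ∀ k' n → odd (teamsJ (suc k') n) ≡ false
teamsJ-even k' n = trans (odd-* m (m ^ 2)) (cong (_∧ odd (m ^ 2)) (mParam-even k' n))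
  where m = mParam (suc k') n

travelFactor-≤ : ∀ {m} → 2 ≤ m → 2 + 4 * (2 * (m ^ 3 ∸ 1)) ≤ 10 * (m * (m ^ 2 ∸ 1))
travelFactor-≤ {suc (suc a)} (s≤s (s≤s z≤n)) = subst₂ _≤_ (sym lhs) (sym rhs) (m≤m+n L R)
  where
  m = suc (suc a)
  L = 58 + 96 * a + 48 * (a * a) + 8 * (a * (a * a))
  R = 2 + 14 * a + 12 * (a * a) + 2 * (a * (a * a))
  m³∸1 : m ^ 3 ∸ 1 ≡ 7 + 12 * a + 6 * (a * a) + a * (a * a)
  m³∸1 = cong (_∸ 1) (solve 1 (λ a → (con 2 :+ a) :* ((con 2 :+ a) :* ((con 2 :+ a) :* con 1))
                        := con 1 :+ (con 7 :+ con 12 :* a :+ con 6 :* (a :* a) :+ a :* (a :* a))) refl a)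
  m²∸1 : m ^ 2 ∸ 1 ≡ 3 + 4 * a + a * a
  m²∸1 = cong (_∸ 1) (solve 1 (λ a → (con 2 :+ a) :* ((con 2 :+ a) :* con 1)
                        := con 1 :+ (con 3 :+ con 4 :* a :+ a :* a)) refl a)
  lhs : 2 + 4 * (2 * (m ^ 3 ∸ 1)) ≡ L
  lhs = trans (cong (λ x → 2 + 4 * (2 * x)) m³∸1)
    (solve 1 (λ a → con 2 :+ con 4 :* (con 2 :* (con 7 :+ con 12 :* a :+ con 6 :* (a :* a) :+ a :* (a :* a)))
                    := con 58 :+ con 96 :* a :+ con 48 :* (a :* a) :+ con 8 :* (a :* (a :* a))) refl a)
  rhs : 10 * (m * (m ^ 2 ∸ 1)) ≡ L + R
  rhs = trans (cong (λ x → 10 * (m * x)) m²∸1)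
    (solve 1 (λ a → con 10 :* ((con 2 :+ a) :* (con 3 :+ con 4 :* a :+ a :* a))
                    := (con 58 :+ con 96 :* a :+ con 48 :* (a :* a) :+ con 8 :* (a :* (a :* a)))
                       :+ (con 2 :+ con 14 :* a :+ con 12 :* (a :* a) :+ con 2 :* (a :* (a :* a)))) refl a)

travelJ-≤ : ∀ {k C n} (I : RestrictedTC k C n) T → 2 ≤ n → IsTourCover I T → 2 ≤ mParam k n →
            (S : Schedule (teamsJ k n)) → IsTTPSchedule S k →
            totalTravel S (distJ I)
              ≤ 10 * C * (k + 1) * (mParam k n * (mParam k n ^ 2 ∸ 1)) * coverCost I T
travelJ-≤ {k} {C} {n} I T 2≤n cover 2≤m S (_ , opp-involutive , _) = begin
  totalTravel S (distJ I)              ≤⟨ totalTravel-≤ 1≤days opp-involutive ⟩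
  (2 + 4 * days S) * Σpotential        ≤⟨ *-mono-≤ (travelFactor-≤ 2≤m) (∑potential-≤ I (teamsJ k n)) ⟩
  (10 * W) * (n * C)                   ≤⟨ *-monoʳ-≤ (10 * W) (*-monoˡ-≤ C (coverCost-bound I T 2≤n cover)) ⟩
  (10 * W) * ((k + 1) * cost * C)      ≡⟨ solve 4 (λ W k1 c C → (con 10 :* W) :* (k1 :* c :* C)
                                                              := con 10 :* C :* k1 :* W :* c) refl W (k + 1) cost C ⟩
  10 * C * (k + 1) * W * cost          ∎
  where
  open ≤-Reasoning
  open TravelBound S (potential I) (distJ-≤ I) using (totalTravel-≤)
  W = mParam k n * (mParam k n ^ 2 ∸ 1)
  cost = coverCost I T
  Σpotential = ∑[ t < teamsJ k n ] potential I t
  1≤days : 1 ≤ days S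
  1≤days = ≤-trans (s≤s z≤n) (*-monoʳ-≤ 2 (∸-monoˡ-≤ 1 (^-monoˡ-≤ 3 2≤m)))

lemma7 : (k C : ℕ) → 3 ≤ k → 1 ≤ C →
    ∃[ α ] (1 ≤ α ×
      (∀ (n : ℕ) → 2 ≤ n → (I : RestrictedTC k C n) →
       ∀ (T : List (List (Fin n))) → IsTourCover I T →
       ∃[ S ] (IsTTPSchedule {teamsJ k n} S k ×
         totalTravel S (distJ I)
           ≤ α * (mParam k n * (mParam k n ^ 2 ∸ 1)) * coverCost I T)))
lemma7 k@(suc k') C 3≤k 1≤C = 10 * C * (k + 1) , 1≤α , λ n 2≤n I T cover →
  let 3≤m = 3≤mParam k n 3≤k 2≤n
      3≤m³ = ≤-trans (s≤s (s≤s (s≤s z≤n))) (^-monoˡ-≤ 3 3≤m)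
      (S , ttp) = ttp-schedule k 3≤k (teamsJ-even k' n) 3≤m³
  in S , ttp , travelJ-≤ I T 2≤n cover (≤-trans (n≤1+n 2) 3≤m) S ttp
  where
  1≤α : 1 ≤ 10 * C * (k + 1)
  1≤α = *-mono-≤ (*-mono-≤ (s≤s (z≤n {9})) 1≤C) (m≤n+m 1 k)
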